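{- Let $f=f_1f_2\cdots f_n\in F_n$ and $\sigma=\phi(f)$. (1) $f_i=i$ if and only if $i$ is the minimum of a cycle of $\sigma$. (2) If $f_i=f_j$, then $i$ and $j$ belong to the same cycle of $\sigma$.
   Context: $[n]=\{1,\dots,n\}$, $\mathfrak{S}_n$ the symmetric group on $[n]$; products of permutations are composed with the leftmost factor acting first: $(\alpha\beta)(x)=\beta(\alpha(x))$. A function $f:[n]\to[n]$ is subexceedant if $1\le f(i)\le i$ for all $i$, written as the word $f_1\cdots f_n$; $F_n$ is the set of such functions. $\phi:F_n\to\mathfrak{S}_n$ is defined by $\phi(f)=(1,f_1)(2,f_2)\cdots(n,f_n)$ (with $(i,i)$ the identity). -}

module Defs where

open import Data.Nat using (ℕ; zero; suc)
open import Data.Fin using (Fin; toℕ; _≟_; _≤_)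
open import Data.List using (List; foldl)
open import Data.List using () renaming (allFin to allFinL)
open import Data.Product using (∃)
open import Relation.Binary.PropositionalEquality using (_≡_)
open import Relation.Nullary using (yes; no)

-- Convention: [n] = {1,…,n} is represented by Fin n = {0,…,n-1}
-- via the order-preserving shift i ↦ i-1.

-- f is subexceedant: f(i) ≤ i for all i (the lower bound 1 ≤ f(i) is
-- automatic in Fin).
Subexceedant : {n : ℕ} → (Fin n → Fin n) → Set
Subexceedant {n} f = ∀ (i : Fin n) → f i ≤ i

transp : {n : ℕ} → Fin n → Fin n → Fin n → Fin n
transp a b x with x ≟ a
... | yes _ = b
... | no _ with x ≟ b
...   | yes _ = a
...   | no _ = x

-- φ(f) = (1,f₁)(2,f₂)⋯(n,fₙ), leftmost factor acting first:
-- φ(f)(x) = (n,fₙ)( ⋯ (1,f₁)(x) ⋯ ).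
phi : {n : ℕ} → (Fin n → Fin n) → Fin n → Fin n
phi {n} f x = foldl (λ y i → transp i (f i) y) x (allFinL n)

iter : {n : ℕ} → (Fin n → Fin n) → ℕ → Fin n → Fin n
iter σ zero x = x
iter σ (suc k) x = σ (iter σ k x)

SameCycle : {n : ℕ} → (Fin n → Fin n) → Fin n → Fin n → Set
SameCycle σ i j = ∃ λ k → iter σ k i ≡ j

IsCycleMin : {n : ℕ} → (Fin n → Fin n) → Fin n → Set
IsCycleMin σ i = ∀ j → SameCycle σ i j → i ≤ j

-- Write σ = φ(f) as the product of the prefixes σₖ = (1,f₁)⋯(k,fₖ). When the
-- factor (k,fₖ) is appended, k is still a fixed point of σₖ₋₁, so every cycle of
-- σₖ₋₁ stays inside a cycle of σₖ, which moreover links k with fₖ. Hence i and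
-- fᵢ lie in one cycle of σ, and (2) follows. Conversely each factor (k,fₖ) swaps
-- two points with the same root, the fixed point of f eventually reached from
-- them by iterating f, so σ preserves roots. The root of j is at most j, and the
-- root of i is i when fᵢ = i, so such an i is the minimum of its cycle; the
-- converse holds because the cycle of i contains fᵢ ≤ i.
module Submission where

open import Defs
open import Data.Nat using (ℕ)
open import Data.Fin using (Fin)
open import Data.Product using (_×_)
open import Function.Bundles using (_⇔_)
open import Relation.Binary.PropositionalEquality using (_≡_)

open import Data.Nat as ℕ using (zero; suc; _+_; _*_)
import Data.Nat.Properties as ℕ
open import Data.Fin using (toℕ; _≟_; _≤_; _<_)
open import Data.Fin.Properties using (≤-refl; ≤-trans; ≤-antisym; ≤∧≢⇒<; <⇒≢; toℕ<n; pigeonhole)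
open import Data.Product using (∃; _,_)
open import Data.Sum using (_⊎_; inj₁; inj₂)
open import Data.List using (List; []; _∷_; foldl; allFin)
open import Data.List.Membership.Propositional using (_∈_)
open import Data.List.Membership.Propositional.Properties using (∈-allFin)
open import Data.List.Relation.Unary.All as All using (All; _∷_)
open import Data.List.Relation.Unary.Any using (here; there)
open import Data.List.Relation.Unary.AllPairs using (AllPairs; _∷_)
open import Data.List.Relation.Unary.AllPairs.Properties using (tabulate⁺-<)
open import Function using (_∘_; id)
open import Function.Bundles using (mk⇔)
open import Function.Definitions using (Injective)
open import Relation.Nullary using (yes; no; contradiction)
open import Relation.Binary.PropositionalEquality using (refl; sym; trans; cong; subst; _≢_; module ≡-Reasoning)

private
  variable
    n : ℕ

transp-left : (a b : Fin n) → transp a b a ≡ b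
transp-left a b with a ≟ a
... | yes _ = refl
... | no a≢a = contradiction refl a≢a

transp-right : (a b : Fin n) → transp a b b ≡ a
transp-right a b with b ≟ a
... | yes b≡a = b≡a
... | no _ with b ≟ b
...   | yes _ = refl
...   | no b≢b = contradiction refl b≢b

transp-fixed : {a b x : Fin n} → x ≢ a → x ≢ b → transp a b x ≡ x
transp-fixed {a = a} {b} {x} x≢a x≢b with x ≟ a
... | yes x≡a = contradiction x≡a x≢a
... | no _ with x ≟ b
...   | yes x≡b = contradiction x≡b x≢b
...   | no _ = refl

transp-involutive : (a b x : Fin n) → transp a b (transp a b x) ≡ x
transp-involutive a b x with x ≟ a
... | yes refl = transp-right a b
... | no x≢a with x ≟ b
...   | yes refl = transp-left a b
...   | no x≢b = transp-fixed x≢a x≢b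

transp-injective : (a b : Fin n) → Injective _≡_ _≡_ (transp a b)
transp-injective a b {x} {y} eq = begin
  x                           ≡⟨ sym (transp-involutive a b x) ⟩
  transp a b (transp a b x)   ≡⟨ cong (transp a b) eq ⟩
  transp a b (transp a b y)   ≡⟨ transp-involutive a b y ⟩
  y                           ∎
  where open ≡-Reasoning

transp-preserves : {A : Set} (g : Fin n → A) {a b : Fin n} → g a ≡ g b →
                   ∀ x → g (transp a b x) ≡ g x
transp-preserves g {a} {b} ga≡gb x with x ≟ a
... | yes refl = sym ga≡gb
... | no _ with x ≟ b
...   | yes refl = ga≡gb
...   | no _ = refl

module _ (σ : Fin n → Fin n) where

  iter-+ : ∀ k m x → iter σ (k + m) x ≡ iter σ k (iter σ m x)
  iter-+ zero    m x = refl
  iter-+ (suc k) m x = cong σ (iter-+ k m x)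

  iter-suc : ∀ m x → iter σ m (σ x) ≡ σ (iter σ m x)
  iter-suc zero    x = refl
  iter-suc (suc m) x = cong σ (iter-suc m x)

  iter-fixed : ∀ {x} → σ x ≡ x → ∀ m → iter σ m x ≡ x
  iter-fixed σx≡x zero    = refl
  iter-fixed σx≡x (suc m) = trans (cong σ (iter-fixed σx≡x m)) σx≡x

  iter-injective : Injective _≡_ _≡_ σ → ∀ m → Injective _≡_ _≡_ (iter σ m)
  iter-injective inj zero    eq = eq
  iter-injective inj (suc m) eq = iter-injective inj m (inj eq)

  iter-periodic : Injective _≡_ _≡_ σ → ∀ x → ∃ λ p → iter σ (suc p) x ≡ x
  iter-periodic inj x with pigeonhole (ℕ.n<1+n n) (λ k → iter σ (toℕ k) x)
  ... | i , j , i<j , iᵗʰ≡jᵗʰ with ℕ.m≤n⇒∃[o]m+o≡n i<j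
  ...   | p , i+1+p≡j = p , sym (iter-injective inj (toℕ i) (begin
    iter σ (toℕ i) x                   ≡⟨ iᵗʰ≡jᵗʰ ⟩
    iter σ (toℕ j) x                   ≡⟨ cong (λ m → iter σ m x) (sym i+1+p≡j) ⟩
    iter σ (suc (toℕ i + p)) x         ≡⟨ cong (λ m → iter σ m x) (sym (ℕ.+-suc (toℕ i) p)) ⟩
    iter σ (toℕ i + suc p) x           ≡⟨ iter-+ (toℕ i) (suc p) x ⟩
    iter σ (toℕ i) (iter σ (suc p) x)  ∎))
    where open ≡-Reasoning

  iter-multiple : ∀ {p x} → iter σ (suc p) x ≡ x → ∀ k → iter σ (k * suc p) x ≡ x
  iter-multiple period zero    = refl
  iter-multiple {p} {x} period (suc k) = begin
    iter σ (suc p + k * suc p) x           ≡⟨ iter-+ (suc p) (k * suc p) x ⟩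
    iter σ (suc p) (iter σ (k * suc p) x)  ≡⟨ cong (iter σ (suc p)) (iter-multiple period k) ⟩
    iter σ (suc p) x                       ≡⟨ period ⟩
    x                                      ∎
    where open ≡-Reasoning

  sameCycle-refl : ∀ {x} → SameCycle σ x x
  sameCycle-refl = 0 , refl

  sameCycle-trans : ∀ {x y z} → SameCycle σ x y → SameCycle σ y z → SameCycle σ x z
  sameCycle-trans {x} (k , refl) (m , refl) = m + k , iter-+ m k x

  sameCycle-sym : Injective _≡_ _≡_ σ → ∀ {x y} → SameCycle σ x y → SameCycle σ y x
  sameCycle-sym inj {x} (m , refl) with iter-periodic inj x
  ... | p , period = m * p , (begin
    iter σ (m * p) (iter σ m x)  ≡⟨ sym (iter-+ (m * p) m x) ⟩
    iter σ (m * p + m) x         ≡⟨ cong (λ k → iter σ k x) (trans (ℕ.+-comm (m * p) m) (sym (ℕ.*-suc m p))) ⟩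
    iter σ (m * suc p) x         ≡⟨ iter-multiple period m ⟩
    x                            ∎)
    where open ≡-Reasoning

  sameCycle-invariant : {A : Set} (g : Fin n → A) → (∀ x → g (σ x) ≡ g x) →
                        ∀ {x y} → SameCycle σ x y → g x ≡ g y
  sameCycle-invariant g g∘σ≡g {x} (m , refl) = sym (iter-invariant m)
    where
    iter-invariant : ∀ m → g (iter σ m x) ≡ g x
    iter-invariant zero    = refl
    iter-invariant (suc m) = trans (g∘σ≡g _) (iter-invariant m)

sameCycle-mono : {σ τ : Fin n → Fin n} → (∀ z → SameCycle τ z (σ z)) →
                 ∀ {x y} → SameCycle σ x y → SameCycle τ x y
sameCycle-mono {σ = σ} {τ} edge {x} (m , refl) = path m
  where
  path : ∀ m → SameCycle τ x (iter σ m x)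
  path zero    = sameCycle-refl τ
  path (suc m) = sameCycle-trans τ (path m) (edge (iter σ m x))

module _ {σ : Fin n → Fin n} (inj : Injective _≡_ _≡_ σ) {a : Fin n} (σa≡a : σ a ≡ a) (b : Fin n) where

  private
    τ : Fin n → Fin n
    τ = transp a b ∘ σ

  sameCycle-transp-edge : ∀ z → SameCycle τ z (σ z)
  sameCycle-transp-edge z with σ z ≟ a
  ... | yes σz≡a = 0 , sym (trans σz≡a (inj (trans σa≡a (sym σz≡a))))
  ... | no σz≢a with σ z ≟ b
  ...   | yes σz≡b = 2 , (begin
    τ (transp a b (σ z))  ≡⟨ cong τ (subst (λ w → transp a b w ≡ a) (sym σz≡b) (transp-right a b)) ⟩
    transp a b (σ a)      ≡⟨ cong (transp a b) σa≡a ⟩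
    transp a b a          ≡⟨ transp-left a b ⟩
    b                     ≡⟨ sym σz≡b ⟩
    σ z                   ∎)
    where open ≡-Reasoning
  ...   | no σz≢b = 1 , transp-fixed σz≢a σz≢b

  sameCycle-transp : ∀ {x y} → SameCycle σ x y → SameCycle τ x y
  sameCycle-transp = sameCycle-mono sameCycle-transp-edge

  sameCycle-transp-link : SameCycle τ a b
  sameCycle-transp-link = 1 , trans (cong (transp a b) σa≡a) (transp-left a b)

module _ (f : Fin n → Fin n) where

  -- The product σ (i₁,f i₁)⋯(iₖ,f iₖ) applied to x; phi f is phiAfter id (allFin n).
  phiAfter : (Fin n → Fin n) → List (Fin n) → Fin n → Fin n
  phiAfter σ is x = foldl (λ y i → transp i (f i) y) (σ x) is

  phiAfter-injective : ∀ {σ} → Injective _≡_ _≡_ σ → ∀ is → Injective _≡_ _≡_ (phiAfter σ is)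
  phiAfter-injective inj []       = inj
  phiAfter-injective inj (i ∷ is) = phiAfter-injective (inj ∘ transp-injective i (f i)) is

  phiAfter-invariant : {A : Set} (g : Fin n → A) → (∀ i → g (f i) ≡ g i) →
                       ∀ σ is x → g (phiAfter σ is x) ≡ g (σ x)
  phiAfter-invariant g g∘f≡g σ []       x = refl
  phiAfter-invariant g g∘f≡g σ (i ∷ is) x =
    trans (phiAfter-invariant g g∘f≡g (transp i (f i) ∘ σ) is x)
          (transp-preserves g (sym (g∘f≡g i)) (σ x))

  module _ (sub : Subexceedant f) where

    Admissible : (Fin n → Fin n) → List (Fin n) → Set
    Admissible σ is = Injective _≡_ _≡_ σ × AllPairs _<_ is × All (λ j → σ j ≡ j) is

    admissible-tail : ∀ {σ i is} → Admissible σ (i ∷ is) → Admissible (transp i (f i) ∘ σ) is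
    admissible-tail {σ} {i} (inj , (i<is ∷ sorted) , (_ ∷ fixed)) =
      inj ∘ transp-injective i (f i) , sorted , All.zipWith stillFixed (i<is , fixed)
      where
      stillFixed : ∀ {j} → i < j × σ j ≡ j → transp i (f i) (σ j) ≡ j
      stillFixed {j} (i<j , σj≡j) = trans (cong (transp i (f i)) σj≡j)
        (transp-fixed (<⇒≢ i<j ∘ sym) (<⇒≢ (ℕ.≤-<-trans (sub i) i<j) ∘ sym))

    phiAfter-sameCycle : ∀ {σ} is → Admissible σ is →
                         ∀ {x y} → SameCycle σ x y → SameCycle (phiAfter σ is) x y
    phiAfter-sameCycle []       _   = id
    phiAfter-sameCycle (i ∷ is) adm@(inj , _ , (σi≡i ∷ _)) =
      phiAfter-sameCycle is (admissible-tail adm) ∘ sameCycle-transp inj σi≡i (f i)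

    phiAfter-link : ∀ {σ} is → Admissible σ is → ∀ {i} → i ∈ is → SameCycle (phiAfter σ is) i (f i)
    phiAfter-link (i ∷ is) adm@(inj , _ , (σi≡i ∷ _)) (here refl) =
      phiAfter-sameCycle is (admissible-tail adm) (sameCycle-transp-link inj σi≡i (f i))
    phiAfter-link (_ ∷ is) adm (there i∈is) = phiAfter-link is (admissible-tail adm) i∈is

    phi-link : ∀ i → SameCycle (phi f) i (f i)
    phi-link i = phiAfter-link (allFin n) (id , tabulate⁺-< id , All.universal (λ _ → refl) _) (∈-allFin i)

    root : Fin n → Fin n
    root = iter f n

    iter-≤ : ∀ m x → iter f m x ≤ x
    iter-≤ zero    x = ≤-refl {x = x}
    iter-≤ (suc m) x = ≤-trans (sub (iter f m x)) (iter-≤ m x)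

    -- Each step that does not reach a fixed point lowers the value by at least one.
    iter-settles : ∀ m x → f (iter f m x) ≡ iter f m x ⊎ m + toℕ (iter f m x) ℕ.≤ toℕ x
    iter-settles zero    x = inj₂ ℕ.≤-refl
    iter-settles (suc m) x with f (iter f m x) ≟ iter f m x
    ... | yes fixed = inj₁ (cong f fixed)
    ... | no moved with iter-settles m x
    ...   | inj₁ fixed = contradiction fixed moved
    ...   | inj₂ bound = inj₂ (begin
      suc m + toℕ (f (iter f m x))    ≡⟨ sym (ℕ.+-suc m _) ⟩
      m + suc (toℕ (f (iter f m x)))  ≤⟨ ℕ.+-monoʳ-≤ m (≤∧≢⇒< (sub _) moved) ⟩
      m + toℕ (iter f m x)            ≤⟨ bound ⟩
      toℕ x                           ∎)
      where open ℕ.≤-Reasoning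

    root-fixed : ∀ x → f (root x) ≡ root x
    root-fixed x with iter-settles n x
    ... | inj₁ fixed = fixed
    ... | inj₂ bound = contradiction (ℕ.m+n≤o⇒m≤o n bound) (ℕ.<⇒≱ (toℕ<n x))

    root-f : ∀ x → root (f x) ≡ root x
    root-f x = trans (iter-suc f n x) (root-fixed x)

    phi-preserves-root : ∀ x → root (phi f x) ≡ root x
    phi-preserves-root = phiAfter-invariant root root-f id (allFin n)

corollary3p1 : (n : ℕ) (f : Fin n → Fin n) → Subexceedant f →
    ((i : Fin n) → (f i ≡ i) ⇔ IsCycleMin (phi f) i)
    × ((i j : Fin n) → f i ≡ f j → SameCycle (phi f) i j)
corollary3p1 n f sub = (λ i → mk⇔ (fixed⇒cycleMin i) (cycleMin⇒fixed i)) , sameCycle-of-equal-images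
  where
  phi-injective : Injective _≡_ _≡_ (phi f)
  phi-injective = phiAfter-injective f id (allFin n)

  fixed⇒cycleMin : ∀ i → f i ≡ i → IsCycleMin (phi f) i
  fixed⇒cycleMin i fi≡i j i~j =
    subst (_≤ j) (trans (sym (sameCycle-invariant (phi f) (root f sub) (phi-preserves-root f sub) i~j))
                        (iter-fixed f fi≡i n))
          (iter-≤ f sub n j)

  cycleMin⇒fixed : ∀ i → IsCycleMin (phi f) i → f i ≡ i
  cycleMin⇒fixed i minimal = ≤-antisym (sub i) (minimal (f i) (phi-link f sub i))

  sameCycle-of-equal-images : ∀ i j → f i ≡ f j → SameCycle (phi f) i j
  sameCycle-of-equal-images i j fi≡fj = sameCycle-trans (phi f) (phi-link f sub i)
    (subst (λ k → SameCycle (phi f) k j) (sym fi≡fj) (sameCycle-sym (phi f) phi-injective (phi-link f sub j)))
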